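{- Let $n\ge 2$ and let $\mathcal{S}_n=(p_0,\ldots,p_{n!-1})$ be ordered by generation by cyclic shift. The word $p_0p_1\cdots p_{n!-1}$ obtained by concatenating the symbols of these permutations in order is a palindrome.
   Context: For $m\ge1$, $\mathcal{S}_m$ is the set of permutations (words using each symbol once) of distinct symbols $x_1,\ldots,x_m$, ordered by generation by cyclic shift: $\mathcal{S}_1=((x_1))$, and if $\mathcal{S}_{m-1}=(q_0,\ldots,q_{(m-1)!-1})$ then $\mathcal{S}_m=(p_0,\ldots,p_{m!-1})$ with $p_{m\beta+j}=C^j(q_\beta x_m)$ for $0\le j\le m-1$, where $q_\beta x_m$ appends $x_m$ on the right and $C(c_1c_2\cdots c_m)=(c_2\cdots c_mc_1)$. -}

module Defs where

open import Data.Nat using (ℕ; zero; suc)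
open import Relation.Binary.PropositionalEquality using (_≡_)
open import Data.List using (List; []; _∷_; _++_; [_]; map; concat; concatMap; upTo; reverse)

-- Symbols x_1,...,x_m are represented by the natural numbers 1,...,m.

C : List ℕ → List ℕ
C []       = []
C (c ∷ cs) = cs ++ [ c ]

Cpow : ℕ → List ℕ → List ℕ
Cpow zero    w = w
Cpow (suc j) w = C (Cpow j w)

-- S 1 = ((x₁)); S m = concat over β of
-- (C^0(q_β x_m), C^1(q_β x_m), …, C^{m-1}(q_β x_m)).
-- (S 0 is unused and set to the empty list.)
S : ℕ → List (List ℕ)
S zero          = []
S (suc zero)    = [ [ 1 ] ]
S (suc (suc k)) =
  concatMap (λ q → map (λ j → Cpow j (q ++ [ suc (suc k) ])) (upTo (suc (suc k))))
            (S (suc k))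

word : ℕ → List ℕ
word m = concat (S m)

Palindrome : List ℕ → Set
Palindrome w = reverse w ≡ w

-- Write w* for the reversal of a word w.  By induction on m, the list S_m
-- reads backwards as its termwise reversal: p_{m!-1-i} = p_i*.  Indeed, if
-- q has length m-1 and q = ab with |a| = j, |b| = i, then
--   (C^j (q x_m))* = (b x_m a)* = a* x_m b* = C^i (q* x_m),
-- so reversing the block of shifts of q x_m and reversing each shift gives
-- the block of q*; since S_{m-1} is symmetric under q ↦ q*, the blocks match
-- up.  Concatenating a list with this symmetry yields a palindrome.
module Submission where

open import Defs
open import Data.Nat using (ℕ; _≥_; zero; suc; _+_)
open import Data.Nat.Properties using (+-comm; suc-injective)
open import Data.List
  using (List; []; _∷_; _++_; [_]; map; concat; upTo; reverse; applyUpTo; applyDownFrom; length)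
open import Data.List.Properties
  using ( ++-assoc; ++-identityʳ; length-++; length-reverse; reverse-++; reverse-involutive
        ; reverse-map; reverse-applyUpTo; map-∘; map-id; map-cong; map-cong-local; map-upTo
        ; concat-map; concat-++; map-++; unfold-reverse )
open import Data.List.Relation.Unary.All as All using (All; []; _∷_)
open import Data.List.Relation.Unary.All.Properties using (concat⁺; map⁺)
open import Function using (_∘_; id)
open import Data.Product using (∃₂; _×_; _,_)
open import Relation.Binary.PropositionalEquality using (_≡_; refl; sym; trans; cong; cong₂)
open Relation.Binary.PropositionalEquality.≡-Reasoning

private
  variable
    A : Set

length-snoc : ∀ (xs : List A) x → length (xs ++ [ x ]) ≡ suc (length xs)
length-snoc xs x = trans (length-++ xs) (+-comm (length xs) 1)

length-C : ∀ w → length (C w) ≡ length w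
length-C []       = refl
length-C (c ∷ cs) = length-snoc cs c

length-Cpow : ∀ j w → length (Cpow j w) ≡ length w
length-Cpow zero    w = refl
length-Cpow (suc j) w = trans (length-C (Cpow j w)) (length-Cpow j w)

Cpow-C : ∀ j w → Cpow j (C w) ≡ C (Cpow j w)
Cpow-C zero    w = refl
Cpow-C (suc j) w = cong C (Cpow-C j w)

Cpow-length-++ : ∀ xs ys → Cpow (length xs) (xs ++ ys) ≡ ys ++ xs
Cpow-length-++ []       ys = sym (++-identityʳ ys)
Cpow-length-++ (x ∷ xs) ys = begin
  C (Cpow (length xs) (x ∷ xs ++ ys))     ≡⟨ Cpow-C (length xs) _ ⟨
  Cpow (length xs) ((xs ++ ys) ++ [ x ])  ≡⟨ cong (Cpow (length xs)) (++-assoc xs ys [ x ]) ⟩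
  Cpow (length xs) (xs ++ (ys ++ [ x ]))  ≡⟨ Cpow-length-++ xs (ys ++ [ x ]) ⟩
  (ys ++ [ x ]) ++ xs                     ≡⟨ ++-assoc ys [ x ] xs ⟩
  ys ++ x ∷ xs                            ∎

reverse-Cpow-snoc : ∀ a b x →
  reverse (Cpow (length a) ((a ++ b) ++ [ x ])) ≡ Cpow (length b) (reverse (a ++ b) ++ [ x ])
reverse-Cpow-snoc a b x = begin
  reverse (Cpow (length a) ((a ++ b) ++ [ x ]))
    ≡⟨ cong (reverse ∘ Cpow (length a)) (++-assoc a b [ x ]) ⟩
  reverse (Cpow (length a) (a ++ b ++ [ x ]))
    ≡⟨ cong reverse (Cpow-length-++ a (b ++ [ x ])) ⟩
  reverse ((b ++ [ x ]) ++ a)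
    ≡⟨ reverse-++ (b ++ [ x ]) a ⟩
  reverse a ++ reverse (b ++ [ x ])
    ≡⟨ cong (reverse a ++_) (reverse-++ b [ x ]) ⟩
  reverse a ++ x ∷ reverse b
    ≡⟨ ++-assoc (reverse a) [ x ] (reverse b) ⟨
  (reverse a ++ [ x ]) ++ reverse b
    ≡⟨ Cpow-length-++ (reverse b) (reverse a ++ [ x ]) ⟨
  Cpow (length (reverse b)) (reverse b ++ reverse a ++ [ x ])
    ≡⟨ cong₂ Cpow (length-reverse b) (sym (++-assoc (reverse b) (reverse a) [ x ])) ⟩
  Cpow (length b) ((reverse b ++ reverse a) ++ [ x ])
    ≡⟨ cong (λ v → Cpow (length b) (v ++ [ x ])) (reverse-++ a b) ⟨
  Cpow (length b) (reverse (a ++ b) ++ [ x ])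
    ∎

split-at : ∀ (xs : List A) i j → i + j ≡ length xs →
           ∃₂ λ a b → a ++ b ≡ xs × length a ≡ i × length b ≡ j
split-at xs       zero    j e  = [] , xs , refl , refl , sym e
split-at []       (suc i) j ()
split-at (x ∷ xs) (suc i) j e  with split-at xs i j (suc-injective e)
... | a , b , refl , refl , refl = x ∷ a , b , refl , refl , refl

applyUpTo≡applyDownFrom : ∀ {f g : ℕ → A} n → (∀ i j → suc (i + j) ≡ n → f i ≡ g j) →
                          applyUpTo f n ≡ applyDownFrom g n
applyUpTo≡applyDownFrom zero    fi≡gj = refl
applyUpTo≡applyDownFrom (suc n) fi≡gj =
  cong₂ _∷_ (fi≡gj 0 n refl) (applyUpTo≡applyDownFrom n λ i j e → fi≡gj (suc i) j (cong suc e))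

shifts : ℕ → List ℕ → List (List ℕ)
shifts m q = map (λ j → Cpow j (q ++ [ m ])) (upTo m)

map-reverse-shifts : ∀ {m} q → suc (length q) ≡ m →
                     map reverse (shifts m q) ≡ reverse (shifts m (reverse q))
map-reverse-shifts {m} q refl = begin
  map reverse (shifts m q)                            ≡⟨ map-∘ (upTo m) ⟨
  map (λ j → reverse (Cpow j (q ++ [ m ]))) (upTo m)  ≡⟨ map-upTo _ m ⟩
  applyUpTo (λ j → reverse (Cpow j (q ++ [ m ]))) m   ≡⟨ applyUpTo≡applyDownFrom m shifted ⟩
  applyDownFrom (λ j → Cpow j (reverse q ++ [ m ])) m ≡⟨ reverse-applyUpTo _ m ⟨
  reverse (applyUpTo (λ j → Cpow j (reverse q ++ [ m ])) m)
    ≡⟨ cong reverse (map-upTo _ m) ⟨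
  reverse (shifts m (reverse q))                      ∎
  where
  shifted : ∀ i j → suc (i + j) ≡ m →
            reverse (Cpow i (q ++ [ m ])) ≡ Cpow j (reverse q ++ [ m ])
  shifted i j e with split-at q i j (suc-injective e)
  ... | a , b , refl , refl , refl = reverse-Cpow-snoc a b m

length-shifts : ∀ {m} q → suc (length q) ≡ m → All (λ p → length p ≡ m) (shifts m q)
length-shifts {m} q refl =
  map⁺ (All.universal (λ j → trans (length-Cpow j (q ++ [ m ])) (length-snoc q m)) (upTo m))

length-S : ∀ k → All (λ p → length p ≡ k) (S k)
length-S zero          = []
length-S (suc zero)    = refl ∷ []
length-S (suc (suc k)) =
  concat⁺ (map⁺ (All.map (λ {q} e → length-shifts q (cong suc e)) (length-S (suc k))))

reverse-concat : ∀ (xss : List (List A)) → reverse (concat xss) ≡ concat (map reverse (reverse xss))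
reverse-concat []         = refl
reverse-concat (xs ∷ xss) = begin
  reverse (xs ++ concat xss)                                  ≡⟨ reverse-++ xs (concat xss) ⟩
  reverse (concat xss) ++ reverse xs
    ≡⟨ cong₂ _++_ (sym (reverse-concat xss)) (++-identityʳ (reverse xs)) ⟨
  concat (map reverse (reverse xss)) ++ concat [ reverse xs ] ≡⟨ concat-++ (map reverse (reverse xss)) _ ⟩
  concat (map reverse (reverse xss) ++ map reverse [ xs ])    ≡⟨ cong concat (map-++ reverse (reverse xss) [ xs ]) ⟨
  concat (map reverse (reverse xss ++ [ xs ]))                ≡⟨ cong (concat ∘ map reverse) (unfold-reverse xs xss) ⟨
  concat (map reverse (reverse (xs ∷ xss)))                   ∎

reverse-S : ∀ k → reverse (S k) ≡ map reverse (S k)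
reverse-S zero          = refl
reverse-S (suc zero)    = refl
reverse-S (suc (suc k)) = begin
  reverse (concat (map G Q))                      ≡⟨ reverse-concat (map G Q) ⟩
  concat (map reverse (reverse (map G Q)))        ≡⟨ cong (concat ∘ map reverse) (reverse-map G Q) ⟨
  concat (map reverse (map G (reverse Q)))        ≡⟨ cong (concat ∘ map reverse ∘ map G) (reverse-S (suc k)) ⟩
  concat (map reverse (map G (map reverse Q)))    ≡⟨ cong (concat ∘ map reverse) (map-∘ Q) ⟨
  concat (map reverse (map (G ∘ reverse) Q))      ≡⟨ cong concat (map-∘ Q) ⟨
  concat (map (reverse ∘ G ∘ reverse) Q)          ≡⟨ cong concat (map-cong-local symmetric) ⟨
  concat (map (map reverse ∘ G) Q)                ≡⟨ cong concat (map-∘ Q) ⟩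
  concat (map (map reverse) (map G Q))            ≡⟨ concat-map (map G Q) ⟩
  map reverse (concat (map G Q))                  ∎
  where
  G : List ℕ → List (List ℕ)
  G = shifts (suc (suc k))
  Q : List (List ℕ)
  Q = S (suc k)
  symmetric : All (λ q → map reverse (G q) ≡ reverse (G (reverse q))) Q
  symmetric = All.map (λ {q} e → map-reverse-shifts q (cong suc e)) (length-S (suc k))

concat-palindrome : ∀ (xss : List (List A)) → reverse xss ≡ map reverse xss →
                    reverse (concat xss) ≡ concat xss
concat-palindrome xss symmetric = begin
  reverse (concat xss)                   ≡⟨ reverse-concat xss ⟩
  concat (map reverse (reverse xss))     ≡⟨ cong (concat ∘ map reverse) symmetric ⟩
  concat (map reverse (map reverse xss)) ≡⟨ cong concat (map-∘ xss) ⟨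
  concat (map (reverse ∘ reverse) xss)   ≡⟨ cong concat (map-cong reverse-involutive xss) ⟩
  concat (map id xss)                    ≡⟨ cong concat (map-id xss) ⟩
  concat xss                             ∎

corollary13 : (n : ℕ) → n ≥ 2 → Palindrome (word n)
corollary13 n _ = concat-palindrome (S n) (reverse-S n)
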